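{- If $T=\{T_1,T_2,T_3\}$ is a $3$-way $(v,3,2)$ trade of volume $7$, then $T$ is a $3$-way $(v,3,2)$ Steiner trade.
   Context: Let $V$ be a set of $v$ elements and let $k,t$ be positive integers with $t<k<v$. A block is a $k$-subset of $V$. A $\mu$-way $(v,k,t)$ trade of volume $m$ is a family $T=\{T_1,\dots,T_\mu\}$ of $\mu$ pairwise disjoint collections of blocks (collections may a priori contain repeated blocks), each $T_i$ consisting of exactly $m$ blocks, such that for every $t$-subset $S$ of $V$, the number of blocks of $T_i$ containing $S$ is the same for all $i$. It is a Steiner trade if every $t$-subset of $V$ is contained in at most one block of each $T_i$. -}

module Defs where

open import Data.Nat using (ℕ; _≡ᵇ_; _≤_)
open import Data.Fin using (Fin)
open import Data.Fin.Subset using (Subset; _⊆_; ∣_∣)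
open import Data.Fin.Subset.Properties using (_⊆?_)
open import Data.List using (List; length; filter)
open import Data.List.Membership.Propositional using (_∈_; _∉_)
open import Relation.Binary.PropositionalEquality using (_≡_; _≢_)

IsKSubset : {v : ℕ} → ℕ → Subset v → Set
IsKSubset k B = ∣ B ∣ ≡ k

-- A collection of blocks (a multiset, represented as a list; repetitions allowed).
Collection : ℕ → Set
Collection v = List (Subset v)

occ : {v : ℕ} → Subset v → Collection v → ℕ
occ S C = length (filter (S ⊆?_) C)

record IsTrade (μ v k t m : ℕ) (T : Fin μ → Collection v) : Set where
  field
    blocks   : ∀ i {B} → B ∈ T i → IsKSubset k B
    volume   : ∀ i → length (T i) ≡ m
    disjoint : ∀ i j → i ≢ j → ∀ {B} → B ∈ T i → B ∉ T j
    balanced : ∀ (S : Subset v) → IsKSubset t S → ∀ i j → occ S (T i) ≡ occ S (T j)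

record IsSteinerTrade (μ v k t m : ℕ) (T : Fin μ → Collection v) : Set where
  field
    trade   : IsTrade μ v k t m T
    steiner : ∀ (S : Subset v) → IsKSubset t S → ∀ i → occ S (T i) ≤ 1

-- Suppose a pair {a , b} lies in λ ≥ 2 blocks of each Tᵢ; pair counts and point degrees
-- agree in all Tᵢ. A block {a , b , d} of Tᵢ lies in no other Tⱼ, so summing the pair
-- counts of {a , d} over all d ∉ {a , b} gives 3λ ≤ λ + 2A, where A counts the blocks
-- through a missing b; likewise 3λ ≤ λ + 2B. Comparing degrees, the blocks of Tᵢ missing
-- both a and b meet every such d at least as often as the blocks {a , b , d} of Tᵢ do,
-- so their number C satisfies λ ≤ 3C. As λ + A + B + C = 7, this forces λ = A = B = 2
-- and C = 1, and all these inequalities are tight. Then a point x with {a , b , x} ∈ Tᵢ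
-- and a point q on the block of Tᵢ missing a and b but on no block through a and b form
-- a pair covered in Tᵢ but not in any other Tⱼ, contradicting balance.
module Submission where

open import Data.Bool using (Bool; true; false; not; _∧_)
open import Data.Empty using (⊥)
open import Data.Fin using (Fin; zero; suc; punchIn)
open import Data.Fin.Properties using (_≟_; punchInᵢ≢i) renaming (any? to anyFin?)
import Data.Fin.Properties as Fin
open import Data.Fin.Subset using (Subset; inside; outside; _⊆_; ∣_∣; ⁅_⁆; _∪_; _-_; Nonempty)
  renaming (_∈_ to _∈ₛ_)
open import Data.Fin.Subset.Properties
  using ( _⊆?_; ⊆-antisym; ∣p∣≤∣x∷p∣; x∈p⇒∣p-x∣<∣p∣; x∈p∧x≢y⇒x∈p-y
        ; ∣⁅x⁆∣≡1; x∈⁅x⁆; x∈⁅y⁆⇒x≡y; x∈p∪q⁺; x∈p∪q⁻)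
  renaming (_∈?_ to _∈ₛ?_)
open import Data.List using (List; []; _∷_; length; lookup; filter)
open import Data.List.Membership.Propositional using (_∈_)
open import Data.List.Membership.Propositional.Properties using (∈-lookup)
open import Data.List.Relation.Unary.All as All using (All; []; _∷_)
open import Data.List.Relation.Unary.All.Properties using (¬Any⇒All¬)
open import Data.List.Relation.Unary.Any using (any?) renaming (here to hereₗ; there to thereₗ)
open import Data.List.Relation.Unary.Unique.Propositional using (Unique; []; _∷_)
open import Data.Nat using (ℕ; zero; suc; _+_; _*_; _≤_; _<_; z≤n; s≤s; s≤s⁻¹; _<?_)
open import Data.Nat.Properties
  using ( ≤-refl; ≤-reflexive; ≤-trans; ≤-antisym; ≤-<-trans; <-irrefl; <⇒≢; ≤∧≢⇒<; ≮⇒≥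
        ; n≤0⇒n≡0; m≤n+m; suc-injective; +-identityʳ; +-assoc; +-suc
        ; +-mono-≤; +-monoˡ-≤; +-monoʳ-≤; +-mono-<-≤; +-mono-≤-<
        ; +-cancelˡ-≡; +-cancelˡ-≤; +-cancelʳ-≤; +-cancelˡ-<
        ; *-identityʳ; *-zeroʳ; *-cancelˡ-≡; *-cancelˡ-≤; *-cancelˡ-<
        ; +-0-commutativeMonoid; +-*-semiring; module ≤-Reasoning)
  renaming (_≟_ to _≟ℕ_)
open import Algebra.Properties.CommutativeMonoid.Sum +-0-commutativeMonoid
  using (sum; sum-syntax; ∑-distrib-+; ∑-comm; sum-cong-≗; sum-replicate-zero; sum-remove)
open import Algebra.Properties.Semiring.Sum +-*-semiring using (*-distribˡ-sum)
open import Data.Nat.Tactic.RingSolver using (solve-∀)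
open import Data.Product using (∃; ∃₂; _×_; _,_; proj₁; proj₂)
open import Data.Sum using (inj₁; inj₂)
open import Data.Vec using ([]; _∷_; here; there)
open import Function using (_∘_; _⇔_; mk⇔; Equivalence)
open import Relation.Binary.PropositionalEquality
open import Relation.Nullary using (Dec; yes; no; does; contradiction; _×-dec_)
open import Relation.Nullary.Decidable using (dec-true; dec-false)
open import Relation.Unary using (Pred; Decidable)

open import Defs

private variable
  n : ℕ

cross-cancel : ∀ {r s s′ x y y′ : ℕ} → r + s ≡ x + y → r + s′ ≡ x + y′ → y + s′ ≡ y′ + s
cross-cancel {r} {s} {s′} {x} {y} {y′} e e′ = +-cancelˡ-≡ (r + x) _ _ (begin
  r + x + (y + s′)   ≡⟨ shuffle r x y s′ ⟩
  x + y + (r + s′)   ≡⟨ cong₂ _+_ (sym e) e′ ⟩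
  r + s + (x + y′)   ≡⟨ shuffle′ r s x y′ ⟩
  r + x + (y′ + s)   ∎)
  where
  open ≡-Reasoning
  shuffle : ∀ r x y s′ → r + x + (y + s′) ≡ x + y + (r + s′)
  shuffle = solve-∀
  shuffle′ : ∀ r s x y′ → r + s + (x + y′) ≡ r + x + (y′ + s)
  shuffle′ = solve-∀

m+n≤1⇒m≡0 : ∀ {m n} → 1 ≤ n → m + n ≤ 1 → m ≡ 0
m+n≤1⇒m≡0 {zero}          _ _               = refl
m+n≤1⇒m≡0 {suc m} {suc n} _ (s≤s m+1+n≤0) = contradiction (≤-trans (m≤n+m (suc n) m) m+1+n≤0) λ ()

+-tight : ∀ {a b x y} → a ≤ x → b ≤ y → x + y ≡ a + b → x ≡ a × y ≡ b
+-tight {a} {b} {x} {y} a≤x b≤y x+y≡a+b =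
  ≤-antisym (+-cancelʳ-≤ b x a (≤-trans (+-monoʳ-≤ x b≤y) (≤-reflexive x+y≡a+b))) a≤x ,
  ≤-antisym (+-cancelˡ-≤ a y b (≤-trans (+-monoˡ-≤ y a≤x) (≤-reflexive x+y≡a+b))) b≤y

∣p∪q∣≤∣p∣+∣q∣ : ∀ (p q : Subset n) → ∣ p ∪ q ∣ ≤ ∣ p ∣ + ∣ q ∣
∣p∪q∣≤∣p∣+∣q∣ []            []            = z≤n
∣p∪q∣≤∣p∣+∣q∣ (inside  ∷ p) (s       ∷ q) =
  s≤s (≤-trans (∣p∪q∣≤∣p∣+∣q∣ p q) (+-monoʳ-≤ ∣ p ∣ (∣p∣≤∣x∷p∣ s q)))
∣p∪q∣≤∣p∣+∣q∣ (outside ∷ p) (inside  ∷ q) =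
  ≤-trans (s≤s (∣p∪q∣≤∣p∣+∣q∣ p q)) (≤-reflexive (sym (+-suc ∣ p ∣ ∣ q ∣)))
∣p∪q∣≤∣p∣+∣q∣ (outside ∷ p) (outside ∷ q) = ∣p∪q∣≤∣p∣+∣q∣ p q

Unique⇒length≤∣p∣ : ∀ {p : Subset n} {xs} → Unique xs → All (_∈ₛ p) xs → length xs ≤ ∣ p ∣
Unique⇒length≤∣p∣ []                                []            = z≤n
Unique⇒length≤∣p∣ {p = p} {x ∷ xs} (x≢xs ∷ xs-un) (x∈p ∷ xs⊆p) =
  ≤-trans (s≤s (Unique⇒length≤∣p∣ xs-un xs⊆p-x)) (x∈p⇒∣p-x∣<∣p∣ x∈p)
  where
  xs⊆p-x : All (_∈ₛ p - x) xs
  xs⊆p-x = All.zipWith (λ (y∈p , x≢y) → x∈p∧x≢y⇒x∈p-y y∈p (x≢y ∘ sym)) (xs⊆p , x≢xs)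

listing-complete : ∀ {p : Subset n} {xs x} → Unique xs → All (_∈ₛ p) xs → ∣ p ∣ ≤ length xs →
                   x ∈ₛ p → x ∈ xs
listing-complete {xs = xs} {x} xs-un xs⊆p ∣p∣≤∣xs∣ x∈p with any? (x ≟_) xs
... | yes x∈xs = x∈xs
... | no  x∉xs = contradiction (≤-trans (Unique⇒length≤∣p∣ x∷xs-un (x∈p ∷ xs⊆p)) ∣p∣≤∣xs∣) (<-irrefl refl)
  where x∷xs-un = ¬Any⇒All¬ xs x∉xs ∷ xs-un

≡-by-listing : ∀ {B B′ : Subset n} {xs} → Unique xs → ∣ B ∣ ≡ length xs → ∣ B′ ∣ ≡ length xs →
               All (_∈ₛ B) xs → All (_∈ₛ B′) xs → B ≡ B′
≡-by-listing xs-un ∣B∣≡ ∣B′∣≡ xs⊆B xs⊆B′ = ⊆-antisym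
  (λ z∈B  → All.lookup xs⊆B′ (listing-complete xs-un xs⊆B  (≤-reflexive ∣B∣≡)  z∈B))
  (λ z∈B′ → All.lookup xs⊆B  (listing-complete xs-un xs⊆B′ (≤-reflexive ∣B′∣≡) z∈B′))

∣p∣≥1⇒Nonempty : ∀ (p : Subset n) → 1 ≤ ∣ p ∣ → Nonempty p
∣p∣≥1⇒Nonempty (inside  ∷ p) _ = zero , here
∣p∣≥1⇒Nonempty (outside ∷ p) h = let x , x∈p = ∣p∣≥1⇒Nonempty p h in suc x , there x∈p

∣p∣≥2⇒two-elements : ∀ (p : Subset n) → 2 ≤ ∣ p ∣ → ∃₂ λ x y → x ≢ y × x ∈ₛ p × y ∈ₛ p
∣p∣≥2⇒two-elements (inside  ∷ p) (s≤s h) =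
  let y , y∈p = ∣p∣≥1⇒Nonempty p h in zero , suc y , (λ ()) , here , there y∈p
∣p∣≥2⇒two-elements (outside ∷ p) h =
  let x , y , x≢y , x∈p , y∈p = ∣p∣≥2⇒two-elements p h
  in suc x , suc y , x≢y ∘ Fin.suc-injective , there x∈p , there y∈p

IsPair : Subset n → Fin n → Fin n → Set
IsPair S x y = ∀ {B} → S ⊆ B ⇔ (x ∈ₛ B × y ∈ₛ B)

∣p∣≡2⇒IsPair : ∀ {S : Subset n} → ∣ S ∣ ≡ 2 → ∃₂ λ x y → x ≢ y × IsPair S x y
∣p∣≡2⇒IsPair {S = S} ∣S∣≡2 with ∣p∣≥2⇒two-elements S (≤-reflexive (sym ∣S∣≡2))
... | x , y , x≢y , x∈S , y∈S = x , y , x≢y , mk⇔ (λ S⊆B → S⊆B x∈S , S⊆B y∈S) from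
  where
  from : ∀ {B} → x ∈ₛ B × y ∈ₛ B → S ⊆ B
  from (x∈B , y∈B) z∈S with listing-complete ((x≢y ∷ []) ∷ [] ∷ []) (x∈S ∷ y∈S ∷ []) (≤-reflexive ∣S∣≡2) z∈S
  ... | hereₗ refl          = x∈B
  ... | thereₗ (hereₗ refl) = y∈B

module _ (x y : Fin n) where

  x∈⁅x⁆∪⁅y⁆ : x ∈ₛ ⁅ x ⁆ ∪ ⁅ y ⁆
  x∈⁅x⁆∪⁅y⁆ = x∈p∪q⁺ (inj₁ (x∈⁅x⁆ x))

  y∈⁅x⁆∪⁅y⁆ : y ∈ₛ ⁅ x ⁆ ∪ ⁅ y ⁆
  y∈⁅x⁆∪⁅y⁆ = x∈p∪q⁺ (inj₂ (x∈⁅x⁆ y))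

  ⁅x⁆∪⁅y⁆-IsPair : IsPair (⁅ x ⁆ ∪ ⁅ y ⁆) x y
  ⁅x⁆∪⁅y⁆-IsPair = mk⇔ (λ S⊆B → S⊆B x∈⁅x⁆∪⁅y⁆ , S⊆B y∈⁅x⁆∪⁅y⁆) from
    where
    from : ∀ {B} → x ∈ₛ B × y ∈ₛ B → ⁅ x ⁆ ∪ ⁅ y ⁆ ⊆ B
    from (x∈B , y∈B) z∈S with x∈p∪q⁻ ⁅ x ⁆ ⁅ y ⁆ z∈S
    ... | inj₁ z∈⁅x⁆ rewrite x∈⁅y⁆⇒x≡y x z∈⁅x⁆ = x∈B
    ... | inj₂ z∈⁅y⁆ rewrite x∈⁅y⁆⇒x≡y y z∈⁅y⁆ = y∈B

  ∣⁅x⁆∪⁅y⁆∣≡2 : x ≢ y → ∣ ⁅ x ⁆ ∪ ⁅ y ⁆ ∣ ≡ 2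
  ∣⁅x⁆∪⁅y⁆∣≡2 x≢y = ≤-antisym
    (≤-trans (∣p∪q∣≤∣p∣+∣q∣ ⁅ x ⁆ ⁅ y ⁆) (≤-reflexive (cong₂ _+_ (∣⁅x⁆∣≡1 x) (∣⁅x⁆∣≡1 y))))
    (Unique⇒length≤∣p∣ ((x≢y ∷ []) ∷ [] ∷ []) (x∈⁅x⁆∪⁅y⁆ ∷ y∈⁅x⁆∪⁅y⁆ ∷ []))

𝟙 : Bool → ℕ
𝟙 true  = 1
𝟙 false = 0

∑-mono-≤ : ∀ {f g : Fin n → ℕ} → (∀ i → f i ≤ g i) → sum f ≤ sum g
∑-mono-≤ {zero}  _   = z≤n
∑-mono-≤ {suc n} f≤g = +-mono-≤ (f≤g zero) (∑-mono-≤ (f≤g ∘ suc))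

∑-mono-< : ∀ {f g : Fin n → ℕ} → (∀ i → f i ≤ g i) → ∀ i → f i < g i → sum f < sum g
∑-mono-< f≤g zero    f₀<g₀ = +-mono-<-≤ f₀<g₀ (∑-mono-≤ (f≤g ∘ suc))
∑-mono-< f≤g (suc i) fᵢ<gᵢ = +-mono-≤-< (f≤g zero) (∑-mono-< (f≤g ∘ suc) i fᵢ<gᵢ)

∑-≡⇒≡ : ∀ {f g : Fin n → ℕ} → (∀ i → f i ≤ g i) → sum f ≡ sum g → ∀ i → f i ≡ g i
∑-≡⇒≡ {f = f} {g} f≤g ∑f≡∑g i with f i ≟ℕ g i
... | yes fᵢ≡gᵢ = fᵢ≡gᵢ
... | no  fᵢ≢gᵢ = contradiction ∑f≡∑g (<⇒≢ (∑-mono-< f≤g i (≤∧≢⇒< (f≤g i) fᵢ≢gᵢ)))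

∑-<⇒∃< : ∀ {f g : Fin n → ℕ} → sum f < sum g → ∃ λ i → f i < g i
∑-<⇒∃< {suc n} {f} {g} ∑f<∑g with f zero <? g zero
... | yes f₀<g₀ = zero , f₀<g₀
... | no  f₀≮g₀ =
  let i , fᵢ<gᵢ = ∑-<⇒∃< (+-cancelˡ-< (g zero) _ _ (≤-<-trans (+-monoˡ-≤ _ (≮⇒≥ f₀≮g₀)) ∑f<∑g))
  in suc i , fᵢ<gᵢ

∑-const : ∀ n c → ∑[ i < n ] c ≡ n * c
∑-const zero    c = refl
∑-const (suc n) c = cong (c +_) (∑-const n c)

∑-single : ∀ {f : Fin n → ℕ} p → (∀ i → i ≢ p → f i ≡ 0) → sum f ≡ f p
∑-single {suc n} {f} p f≡0 = begin
  sum f                            ≡⟨ sum-remove {i = p} f ⟩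
  f p + ∑[ j < n ] f (punchIn p j) ≡⟨ cong (f p +_) (sum-cong-≗ (λ j → f≡0 _ (punchInᵢ≢i p j))) ⟩
  f p + ∑[ j < n ] 0               ≡⟨ cong (f p +_) (sum-replicate-zero n) ⟩
  f p + 0                          ≡⟨ +-identityʳ (f p) ⟩
  f p                              ∎
  where open ≡-Reasoning

∑-≤-single-support : ∀ {f : Fin n → ℕ} {c} → (∀ i j → 0 < f i → 0 < f j → i ≡ j) → (∀ i → f i ≤ c) →
                     sum f ≤ c
∑-≤-single-support {n} {f} {c} single f≤c with anyFin? (λ i → 0 <? f i)
... | yes (i , 0<fᵢ) = ≤-trans (≤-reflexive (∑-single i off-i)) (f≤c i)
  where off-i = λ j j≢i → n≤0⇒n≡0 (≮⇒≥ (j≢i ∘ λ 0<fⱼ → single j i 0<fⱼ 0<fᵢ))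
... | no  ∄i = ≤-trans (≤-reflexive (trans (sum-cong-≗ zero-everywhere) (sum-replicate-zero n))) z≤n
  where zero-everywhere = λ i → n≤0⇒n≡0 (≮⇒≥ (∄i ∘ (i ,_)))

-- Opaque, so that the weight and the summand can be recovered by unification.
opaque
  ∑⟨_⟩ : (Fin n → Bool) → (Fin n → ℕ) → ℕ
  ∑⟨ w ⟩ f = sum (λ i → 𝟙 (w i) * f i)

𝟙*-mono-≤ : ∀ w {x y} → (w ≡ true → x ≤ y) → 𝟙 w * x ≤ 𝟙 w * y
𝟙*-mono-≤ true  x≤y = +-monoˡ-≤ 0 (x≤y refl)
𝟙*-mono-≤ false _   = z≤n

𝟙*-<⇒ : ∀ w {x y} → 𝟙 w * x < 𝟙 w * y → w ≡ true × x < y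
𝟙*-<⇒ true {x} {y} x<y = refl , subst₂ _<_ (+-identityʳ x) (+-identityʳ y) x<y

𝟙*-cancel : ∀ {w x y} → w ≡ true → 𝟙 w * x ≡ 𝟙 w * y → x ≡ y
𝟙*-cancel {x = x} {y} refl = *-cancelˡ-≡ x y 1

module _ {w : Fin n → Bool} where

  private
    _·_ : (Fin n → ℕ) → Fin n → ℕ
    (f · i) = 𝟙 (w i) * f i

  opaque
    unfolding ∑⟨_⟩

    ∑⟨⟩-mono-≤ : ∀ {f g} → (∀ i → w i ≡ true → f i ≤ g i) → ∑⟨ w ⟩ f ≤ ∑⟨ w ⟩ g
    ∑⟨⟩-mono-≤ {f} {g} f≤g = ∑-mono-≤ {f = f ·_} {g = g ·_} (λ i → 𝟙*-mono-≤ (w i) (f≤g i))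

    ∑⟨⟩-<⇒∃< : ∀ {f g} → ∑⟨ w ⟩ f < ∑⟨ w ⟩ g → ∃ λ i → w i ≡ true × f i < g i
    ∑⟨⟩-<⇒∃< {f} {g} ∑f<∑g = let i , fᵢ<gᵢ = ∑-<⇒∃< {f = f ·_} {g = g ·_} ∑f<∑g in i , 𝟙*-<⇒ (w i) fᵢ<gᵢ

    ∑⟨⟩-≡⇒≡ : ∀ {f g} → (∀ i → w i ≡ true → f i ≤ g i) → ∑⟨ w ⟩ f ≡ ∑⟨ w ⟩ g →
              ∀ i → w i ≡ true → f i ≡ g i
    ∑⟨⟩-≡⇒≡ {f} {g} f≤g ∑f≡∑g i wᵢ =
      𝟙*-cancel wᵢ (∑-≡⇒≡ {f = f ·_} {g = g ·_} (λ j → 𝟙*-mono-≤ (w j) (f≤g j)) ∑f≡∑g i)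

    ∑⟨⟩-zero : ∑⟨ w ⟩ (λ _ → 0) ≡ 0
    ∑⟨⟩-zero = trans (sum-cong-≗ (λ i → *-zeroʳ (𝟙 (w i)))) (sum-replicate-zero n)

    ∑⟨⟩-*ˡ : ∀ c f → ∑⟨ w ⟩ (λ i → c * f i) ≡ c * ∑⟨ w ⟩ f
    ∑⟨⟩-*ˡ c f = trans (sum-cong-≗ (λ i → x*[y*z]≡y*[x*z] (𝟙 (w i)) c (f i))) (sym (*-distribˡ-sum c (f ·_)))
      where
      x*[y*z]≡y*[x*z] : ∀ x y z → x * (y * z) ≡ y * (x * z)
      x*[y*z]≡y*[x*z] = solve-∀

    ∑⟨⟩-∑-comm : ∀ {m} (g : Fin m → Fin n → ℕ) → ∑⟨ w ⟩ (λ i → ∑[ k < m ] g k i) ≡ ∑[ k < m ] ∑⟨ w ⟩ (g k)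
    ∑⟨⟩-∑-comm g = trans (sum-cong-≗ (λ i → *-distribˡ-sum (𝟙 (w i)) (λ k → g k i)))
                         (∑-comm (λ i k → 𝟙 (w i) * g k i))

  ∑⟨⟩-cong : ∀ {f g} → (∀ i → w i ≡ true → f i ≡ g i) → ∑⟨ w ⟩ f ≡ ∑⟨ w ⟩ g
  ∑⟨⟩-cong f≡g = ≤-antisym (∑⟨⟩-mono-≤ (λ i wᵢ → ≤-reflexive (f≡g i wᵢ)))
                           (∑⟨⟩-mono-≤ (λ i wᵢ → ≤-reflexive (sym (f≡g i wᵢ))))

  ∑⟨⟩-pos : ∀ {f} → 0 < ∑⟨ w ⟩ f → ∃ λ i → w i ≡ true × 0 < f i
  ∑⟨⟩-pos {f} 0<∑f = ∑⟨⟩-<⇒∃< {f = λ _ → 0} (subst (_< ∑⟨ w ⟩ f) (sym ∑⟨⟩-zero) 0<∑f)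

_≢ᵇ_ : Fin n → Fin n → Bool
i ≢ᵇ j = not (does (i ≟ j))

≢ᵇ⇒≢ : ∀ {i j : Fin n} → i ≢ᵇ j ≡ true → i ≢ j
≢ᵇ⇒≢ {i = i} {j} _ with i ≟ j
... | no i≢j = i≢j

away : Fin n → Fin n → Fin n → Bool
away a b i = (i ≢ᵇ a) ∧ (i ≢ᵇ b)

away⇒≢ : ∀ (a b i : Fin n) → away a b i ≡ true → i ≢ a × i ≢ b
away⇒≢ a b i _ with i ≟ a | i ≟ b
... | no i≢a | no i≢b = i≢a , i≢b

opaque
  unfolding ∑⟨_⟩

  ∑-split : ∀ (f : Fin n → ℕ) p → sum f ≡ f p + ∑⟨ _≢ᵇ p ⟩ f
  ∑-split {n} f p = begin
    sum f                                 ≡⟨ sum-cong-≗ (λ i → 𝟙-partition (does (i ≟ p)) (f i)) ⟩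
    sum (λ i → at i + 𝟙 (i ≢ᵇ p) * f i)  ≡⟨ ∑-distrib-+ at (λ i → 𝟙 (i ≢ᵇ p) * f i) ⟩
    sum at + ∑⟨ _≢ᵇ p ⟩ f                ≡⟨ cong (_+ ∑⟨ _≢ᵇ p ⟩ f) at-p ⟩
    f p + ∑⟨ _≢ᵇ p ⟩ f                    ∎
    where
    open ≡-Reasoning
    at : Fin n → ℕ
    at i = 𝟙 (does (i ≟ p)) * f i
    𝟙-partition : ∀ b x → x ≡ 𝟙 b * x + 𝟙 (not b) * x
    𝟙-partition true  x = sym (trans (+-identityʳ (x + 0)) (+-identityʳ x))
    𝟙-partition false x = sym (+-identityʳ x)
    at-p : sum at ≡ f p
    at-p = trans (∑-single p (λ i i≢p → cong (λ b → 𝟙 b * f i) (dec-false (i ≟ p) i≢p)))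
                 (trans (cong (λ b → 𝟙 b * f p) (dec-true (p ≟ p) refl)) (+-identityʳ (f p)))

  ∑-split₂ : ∀ (f : Fin n → ℕ) {a b} → a ≢ b → sum f ≡ f a + f b + ∑⟨ away a b ⟩ f
  ∑-split₂ f {a} {b} a≢b = begin
    sum f                                                           ≡⟨ ∑-split f a ⟩
    f a + ∑⟨ _≢ᵇ a ⟩ f                                              ≡⟨ cong (f a +_) (∑-split _ b) ⟩
    f a + (𝟙 (b ≢ᵇ a) * f b + ∑⟨ _≢ᵇ b ⟩ (λ i → 𝟙 (i ≢ᵇ a) * f i)) ≡⟨ cong (f a +_) (cong₂ _+_ at-b off-a-b) ⟩
    f a + (f b + ∑⟨ away a b ⟩ f)                                   ≡⟨ +-assoc (f a) (f b) _ ⟨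
    f a + f b + ∑⟨ away a b ⟩ f                                     ∎
    where
    open ≡-Reasoning
    at-b : 𝟙 (b ≢ᵇ a) * f b ≡ f b
    at-b = trans (cong (λ x → 𝟙 (not x) * f b) (dec-false (b ≟ a) (a≢b ∘ sym))) (+-identityʳ (f b))
    𝟙-∧ : ∀ x y z → 𝟙 y * (𝟙 x * z) ≡ 𝟙 (x ∧ y) * z
    𝟙-∧ true  true  z = +-identityʳ (z + 0)
    𝟙-∧ true  false z = refl
    𝟙-∧ false y     z = *-zeroʳ (𝟙 y)
    off-a-b : ∑⟨ _≢ᵇ b ⟩ (λ i → 𝟙 (i ≢ᵇ a) * f i) ≡ ∑⟨ away a b ⟩ f
    off-a-b = sum-cong-≗ (λ i → 𝟙-∧ (i ≢ᵇ a) (i ≢ᵇ b) (f i))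

_∈ᵇ_ : Fin n → Subset n → Bool
x ∈ᵇ p = does (x ∈ₛ? p)

∈ᵇ⇒∈ : ∀ {x} {p : Subset n} → x ∈ᵇ p ≡ true → x ∈ₛ p
∈ᵇ⇒∈ {x = x} {p} _ with x ∈ₛ? p
... | yes x∈p = x∈p

𝟙[_∈_] : Fin n → Subset n → ℕ
𝟙[ x ∈ p ] = 𝟙 (x ∈ᵇ p)

𝟙[_∉_] : Fin n → Subset n → ℕ
𝟙[ x ∉ p ] = 𝟙 (not (x ∈ᵇ p))

∣p∣≡∑𝟙 : ∀ (p : Subset n) → ∣ p ∣ ≡ ∑[ x < n ] 𝟙[ x ∈ p ]
∣p∣≡∑𝟙 []            = refl
∣p∣≡∑𝟙 (inside  ∷ p) = cong suc (∣p∣≡∑𝟙 p)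
∣p∣≡∑𝟙 (outside ∷ p) = ∣p∣≡∑𝟙 p

module _ {A : Set} where

  opaque
    sumOver : List A → (A → ℕ) → ℕ
    sumOver xs f = ∑[ k < length xs ] f (lookup xs k)

  infix 5 sumOver
  syntax sumOver xs (λ x → e) = ∑[ x ∈ xs ] e

  opaque
    unfolding sumOver

    ∑∈-mono-≤ : ∀ {xs} {f g : A → ℕ} → (∀ {x} → x ∈ xs → f x ≤ g x) → (∑[ x ∈ xs ] f x) ≤ (∑[ x ∈ xs ] g x)
    ∑∈-mono-≤ {xs} {f} {g} f≤g = ∑-mono-≤ {f = f ∘ lookup xs} {g = g ∘ lookup xs} (λ k → f≤g (∈-lookup k))

    ∑∈-cong : ∀ {xs} {f g : A → ℕ} → (∀ {x} → x ∈ xs → f x ≡ g x) → (∑[ x ∈ xs ] f x) ≡ (∑[ x ∈ xs ] g x)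
    ∑∈-cong f≡g = sum-cong-≗ (λ k → f≡g (∈-lookup k))

    ∑∈-pos : ∀ {xs} {f : A → ℕ} → 0 < (∑[ x ∈ xs ] f x) → ∃ λ x → x ∈ xs × 0 < f x
    ∑∈-pos {xs} {f} 0<∑f
      with ∑-<⇒∃< {f = λ _ → 0} {g = f ∘ lookup xs}
                   (subst (_< sum (f ∘ lookup xs)) (sym (sum-replicate-zero (length xs))) 0<∑f)
    ... | k , 0<fₖ = lookup xs k , ∈-lookup k , 0<fₖ

    ∑∈-distrib-+ : ∀ xs (f g : A → ℕ) → (∑[ x ∈ xs ] f x + g x) ≡ (∑[ x ∈ xs ] f x) + (∑[ x ∈ xs ] g x)
    ∑∈-distrib-+ xs f g = ∑-distrib-+ (f ∘ lookup xs) (g ∘ lookup xs)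

    ∑∈-*ˡ : ∀ xs c (f : A → ℕ) → (∑[ x ∈ xs ] c * f x) ≡ c * (∑[ x ∈ xs ] f x)
    ∑∈-*ˡ xs c f = sym (*-distribˡ-sum c (f ∘ lookup xs))

    length≡∑∈1 : ∀ xs → length xs ≡ (∑[ x ∈ xs ] 1)
    length≡∑∈1 xs = sym (trans (∑-const (length xs) 1) (*-identityʳ (length xs)))

    length-filter≡∑∈ : ∀ {ℓ} {P : Pred A ℓ} (P? : Decidable P) xs →
                       length (filter P? xs) ≡ (∑[ x ∈ xs ] 𝟙 (does (P? x)))
    length-filter≡∑∈ P? []       = refl
    length-filter≡∑∈ P? (x ∷ xs) with does (P? x)
    ... | true  = cong suc (length-filter≡∑∈ P? xs)
    ... | false = length-filter≡∑∈ P? xs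

opaque
  unfolding ∑⟨_⟩ sumOver

  ∑⟨⟩-blocks : ∀ (w : Fin n → Bool) C (K : Subset n → ℕ) →
               ∑⟨ w ⟩ (λ d → ∑[ B ∈ C ] K B * 𝟙[ d ∈ B ]) ≡ (∑[ B ∈ C ] K B * ∑⟨ w ⟩ (λ d → 𝟙[ d ∈ B ]))
  ∑⟨⟩-blocks {n} w C K = trans (∑⟨⟩-∑-comm {w = w} (λ k d → K (Bₖ k) * 𝟙[ d ∈ Bₖ k ]))
                           (sum-cong-≗ (λ k → ∑⟨⟩-*ˡ {w = w} (K (Bₖ k)) (λ d → 𝟙[ d ∈ Bₖ k ])))
    where
    Bₖ : Fin (length C) → Subset n
    Bₖ = lookup C

-- Degrees and codegrees

does-⇔ : ∀ {a b} {P : Set a} {Q : Set b} → P ⇔ Q → (P? : Dec P) (Q? : Dec Q) → does P? ≡ does Q?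
does-⇔ P⇔Q P? (yes q) = dec-true  P? (Equivalence.from P⇔Q q)
does-⇔ P⇔Q P? (no ¬q) = dec-false P? (¬q ∘ Equivalence.to P⇔Q)

module _ {v : ℕ} where

  deg : Collection v → Fin v → ℕ
  deg C x = ∑[ B ∈ C ] 𝟙[ x ∈ B ]

  codeg : Collection v → Fin v → Fin v → ℕ
  codeg C x y = ∑[ B ∈ C ] 𝟙[ x ∈ B ] * 𝟙[ y ∈ B ]

  occ-pair : ∀ {S : Subset v} {x y} → IsPair S x y → ∀ C → occ S C ≡ codeg C x y
  occ-pair {S} {x} {y} S≈xy C = trans (length-filter≡∑∈ (S ⊆?_) C) (∑∈-cong (λ {B} _ → per-block B))
    where
    𝟙-∧ : ∀ p q → 𝟙 (p ∧ q) ≡ 𝟙 p * 𝟙 q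
    𝟙-∧ true  q = sym (+-identityʳ (𝟙 q))
    𝟙-∧ false q = refl
    per-block : ∀ B → 𝟙 (does (S ⊆? B)) ≡ 𝟙[ x ∈ B ] * 𝟙[ y ∈ B ]
    per-block B = trans (cong 𝟙 (does-⇔ S≈xy (S ⊆? B) (x ∈ₛ? B ×-dec y ∈ₛ? B))) (𝟙-∧ (x ∈ᵇ B) (y ∈ᵇ B))

  ∑codeg≡*deg : ∀ {k} C x → (∀ {B} → B ∈ C → IsKSubset (suc k) B) → ∑⟨ _≢ᵇ x ⟩ (codeg C x) ≡ k * deg C x
  ∑codeg≡*deg {k} C x uniform = begin
    ∑⟨ _≢ᵇ x ⟩ (codeg C x)                                    ≡⟨ ∑⟨⟩-blocks (_≢ᵇ x) C (λ B → 𝟙[ x ∈ B ]) ⟩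
    (∑[ B ∈ C ] 𝟙[ x ∈ B ] * ∑⟨ _≢ᵇ x ⟩ (λ d → 𝟙[ d ∈ B ])) ≡⟨ ∑∈-cong per-block ⟩
    (∑[ B ∈ C ] k * 𝟙[ x ∈ B ])                              ≡⟨ ∑∈-*ˡ C k _ ⟩
    k * deg C x                                               ∎
    where
    open ≡-Reasoning
    others : ∀ b n → 𝟙 b + n ≡ suc k → 𝟙 b * n ≡ k * 𝟙 b
    others true  n 1+n≡1+k = trans (+-identityʳ n) (trans (suc-injective 1+n≡1+k) (sym (*-identityʳ k)))
    others false n _       = sym (*-zeroʳ k)
    per-block : ∀ {B} → B ∈ C → 𝟙[ x ∈ B ] * ∑⟨ _≢ᵇ x ⟩ (λ d → 𝟙[ d ∈ B ]) ≡ k * 𝟙[ x ∈ B ]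
    per-block {B} B∈C =
      others _ _ (trans (sym (∑-split (λ d → 𝟙[ d ∈ B ]) x)) (trans (sym (∣p∣≡∑𝟙 B)) (uniform B∈C)))

module _ {μ v k m} {T : Fin μ → Collection v} (trade : IsTrade μ v k 2 m T) where
  open IsTrade trade

  codeg-balanced : ∀ {x y} → x ≢ y → ∀ i j → codeg (T i) x y ≡ codeg (T j) x y
  codeg-balanced {x} {y} x≢y i j = begin
    codeg (T i) x y            ≡⟨ occ-pair (⁅x⁆∪⁅y⁆-IsPair x y) (T i) ⟨
    occ (⁅ x ⁆ ∪ ⁅ y ⁆) (T i)  ≡⟨ balanced (⁅ x ⁆ ∪ ⁅ y ⁆) (∣⁅x⁆∪⁅y⁆∣≡2 x y x≢y) i j ⟩
    occ (⁅ x ⁆ ∪ ⁅ y ⁆) (T j)  ≡⟨ occ-pair (⁅x⁆∪⁅y⁆-IsPair x y) (T j) ⟩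
    codeg (T j) x y            ∎
    where open ≡-Reasoning

deg-balanced : ∀ {μ v k m} {T : Fin μ → Collection v} → IsTrade μ v (2 + k) 2 m T →
               ∀ x i j → deg (T i) x ≡ deg (T j) x
deg-balanced {k = k} {T = T} trade x i j = *-cancelˡ-≡ _ _ (suc k) (begin
  suc k * deg (T i) x         ≡⟨ ∑codeg≡*deg (T i) x (blocks i) ⟨
  ∑⟨ _≢ᵇ x ⟩ (codeg (T i) x)  ≡⟨ ∑⟨⟩-cong (λ y y≢ᵇx → codeg-balanced trade {x} {y} (≢ᵇ⇒≢ y≢ᵇx ∘ sym) i j) ⟩
  ∑⟨ _≢ᵇ x ⟩ (codeg (T j) x)  ≡⟨ ∑codeg≡*deg (T j) x (blocks j) ⟩
  suc k * deg (T j) x         ∎)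
  where
  open ≡-Reasoning
  open IsTrade trade

-- Blocks around a pair {a , b}

module AroundPair {v} {a b : Fin v} (a≢b : a ≢ b) where

  onlyA onlyB neither : Collection v → ℕ
  onlyA   C = ∑[ B ∈ C ] 𝟙[ a ∈ B ] * 𝟙[ b ∉ B ]
  onlyB   C = ∑[ B ∈ C ] 𝟙[ a ∉ B ] * 𝟙[ b ∈ B ]
  neither C = ∑[ B ∈ C ] 𝟙[ a ∉ B ] * 𝟙[ b ∉ B ]

  withAB withoutAB : Collection v → Fin v → ℕ
  withAB    C d = ∑[ B ∈ C ] 𝟙[ a ∈ B ] * 𝟙[ b ∈ B ] * 𝟙[ d ∈ B ]
  withoutAB C d = ∑[ B ∈ C ] 𝟙[ a ∉ B ] * 𝟙[ b ∉ B ] * 𝟙[ d ∈ B ]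

  ∑away : (Fin v → ℕ) → ℕ
  ∑away = ∑⟨ away a b ⟩

  a≢away : ∀ d → away a b d ≡ true → a ≢ d
  a≢away d away-d = proj₁ (away⇒≢ a b d away-d) ∘ sym

  b≢away : ∀ d → away a b d ≡ true → b ≢ d
  b≢away d away-d = proj₂ (away⇒≢ a b d away-d) ∘ sym

  ∣p∣≡𝟙a+𝟙b+∑away : ∀ B → ∣ B ∣ ≡ 𝟙[ a ∈ B ] + 𝟙[ b ∈ B ] + ∑away (λ d → 𝟙[ d ∈ B ])
  ∣p∣≡𝟙a+𝟙b+∑away B = trans (∣p∣≡∑𝟙 B) (∑-split₂ (λ d → 𝟙[ d ∈ B ]) a≢b)

  volume-partition : ∀ C → length C ≡ codeg C a b + onlyA C + onlyB C + neither C
  volume-partition C = begin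
    length C
      ≡⟨ length≡∑∈1 C ⟩
    (∑[ B ∈ C ] 1)
      ≡⟨ ∑∈-cong (λ {B} _ → partition (a ∈ᵇ B) (b ∈ᵇ B)) ⟩
    (∑[ B ∈ C ] 𝟙[ a ∈ B ] * 𝟙[ b ∈ B ] + 𝟙[ a ∈ B ] * 𝟙[ b ∉ B ]
                + 𝟙[ a ∉ B ] * 𝟙[ b ∈ B ] + 𝟙[ a ∉ B ] * 𝟙[ b ∉ B ])
      ≡⟨ ∑∈-distrib-+ C _ _ ⟩
    _
      ≡⟨ cong (_+ neither C) (∑∈-distrib-+ C _ _) ⟩
    _
      ≡⟨ cong (λ s → s + onlyB C + neither C) (∑∈-distrib-+ C _ _) ⟩
    codeg C a b + onlyA C + onlyB C + neither C
      ∎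
    where
    open ≡-Reasoning
    partition : ∀ α β → 1 ≡ 𝟙 α * 𝟙 β + 𝟙 α * 𝟙 (not β) + 𝟙 (not α) * 𝟙 β + 𝟙 (not α) * 𝟙 (not β)
    partition true  true  = refl
    partition true  false = refl
    partition false true  = refl
    partition false false = refl

  module _ {C : Collection v} (uniform : ∀ {B} → B ∈ C → IsKSubset 3 B) where

    -- n is the number of points of the block other than a and b.
    ∑away-blocks : ∀ (K F : Bool → Bool → ℕ) → (∀ α β n → 𝟙 α + 𝟙 β + n ≡ 3 → K α β * n ≡ F α β) →
                   ∑away (λ d → ∑[ B ∈ C ] K (a ∈ᵇ B) (b ∈ᵇ B) * 𝟙[ d ∈ B ]) ≡ (∑[ B ∈ C ] F (a ∈ᵇ B) (b ∈ᵇ B))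
    ∑away-blocks K F K*n≡F = trans (∑⟨⟩-blocks (away a b) C (λ B → K (a ∈ᵇ B) (b ∈ᵇ B)))
      (∑∈-cong (λ {B} B∈C → K*n≡F _ _ _ (trans (sym (∣p∣≡𝟙a+𝟙b+∑away B)) (uniform B∈C))))

    ∑away-codeg-a : ∑away (codeg C a) ≡ codeg C a b + 2 * onlyA C
    ∑away-codeg-a = trans (∑away-blocks (λ α _ → 𝟙 α) (λ α β → 𝟙 α * 𝟙 β + 2 * (𝟙 α * 𝟙 (not β))) count)
                          (trans (∑∈-distrib-+ C _ _) (cong (codeg C a b +_) (∑∈-*ˡ C 2 _)))
      where
      count : ∀ α β n → 𝟙 α + 𝟙 β + n ≡ 3 → 𝟙 α * n ≡ 𝟙 α * 𝟙 β + 2 * (𝟙 α * 𝟙 (not β))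
      count true  true  .1 refl = refl
      count true  false .2 refl = refl
      count false β     n  _    = refl

    ∑away-codeg-b : ∑away (codeg C b) ≡ codeg C a b + 2 * onlyB C
    ∑away-codeg-b = trans (∑away-blocks (λ _ β → 𝟙 β) (λ α β → 𝟙 α * 𝟙 β + 2 * (𝟙 (not α) * 𝟙 β)) count)
                          (trans (∑∈-distrib-+ C _ _) (cong (codeg C a b +_) (∑∈-*ˡ C 2 _)))
      where
      count : ∀ α β n → 𝟙 α + 𝟙 β + n ≡ 3 → 𝟙 β * n ≡ 𝟙 α * 𝟙 β + 2 * (𝟙 (not α) * 𝟙 β)
      count true  true  .1 refl = refl
      count false true  .2 refl = refl
      count true  false n  _    = refl
      count false false n  _    = refl

    ∑away-withAB : ∑away (withAB C) ≡ codeg C a b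
    ∑away-withAB = ∑away-blocks (λ α β → 𝟙 α * 𝟙 β) (λ α β → 𝟙 α * 𝟙 β) count
      where
      count : ∀ α β n → 𝟙 α + 𝟙 β + n ≡ 3 → 𝟙 α * 𝟙 β * n ≡ 𝟙 α * 𝟙 β
      count true  true  .1 refl = refl
      count true  false n  _    = refl
      count false β     n  _    = refl

    ∑away-withoutAB : ∑away (withoutAB C) ≡ 3 * neither C
    ∑away-withoutAB =
      trans (∑away-blocks (λ α β → 𝟙 (not α) * 𝟙 (not β)) (λ α β → 3 * (𝟙 (not α) * 𝟙 (not β))) count)
            (∑∈-*ˡ C 3 _)
      where
      count : ∀ α β n → 𝟙 α + 𝟙 β + n ≡ 3 → 𝟙 (not α) * 𝟙 (not β) * n ≡ 3 * (𝟙 (not α) * 𝟙 (not β))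
      count false false .3 refl = refl
      count false true  n  _    = refl
      count true  β     n  _    = refl

  module _ (C : Collection v) where

    inclusion-exclusion : ∀ d → deg C d + withAB C d ≡ codeg C a d + codeg C b d + withoutAB C d
    inclusion-exclusion d = begin
      deg C d + withAB C d
        ≡⟨ ∑∈-distrib-+ C _ _ ⟨
      (∑[ B ∈ C ] 𝟙[ d ∈ B ] + 𝟙[ a ∈ B ] * 𝟙[ b ∈ B ] * 𝟙[ d ∈ B ])
        ≡⟨ ∑∈-cong (λ {B} _ → per-block (a ∈ᵇ B) (b ∈ᵇ B) (d ∈ᵇ B)) ⟩
      (∑[ B ∈ C ] 𝟙[ a ∈ B ] * 𝟙[ d ∈ B ] + 𝟙[ b ∈ B ] * 𝟙[ d ∈ B ] + 𝟙[ a ∉ B ] * 𝟙[ b ∉ B ] * 𝟙[ d ∈ B ])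
        ≡⟨ ∑∈-distrib-+ C _ _ ⟩
      _
        ≡⟨ cong (_+ withoutAB C d) (∑∈-distrib-+ C _ _) ⟩
      codeg C a d + codeg C b d + withoutAB C d
        ∎
      where
      open ≡-Reasoning
      per-block : ∀ α β δ → 𝟙 δ + 𝟙 α * 𝟙 β * 𝟙 δ ≡ 𝟙 α * 𝟙 δ + 𝟙 β * 𝟙 δ + 𝟙 (not α) * 𝟙 (not β) * 𝟙 δ
      per-block true  true  true  = refl
      per-block true  false true  = refl
      per-block false true  true  = refl
      per-block false false true  = refl
      per-block true  true  false = refl
      per-block true  false false = refl
      per-block false true  false = refl
      per-block false false false = refl

    withAB≤codeg-a : ∀ d → withAB C d ≤ codeg C a d
    withAB≤codeg-a d = ∑∈-mono-≤ (λ {B} _ → per-block (a ∈ᵇ B) (b ∈ᵇ B) (d ∈ᵇ B))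
      where
      per-block : ∀ α β δ → 𝟙 α * 𝟙 β * 𝟙 δ ≤ 𝟙 α * 𝟙 δ
      per-block true  true  true  = ≤-refl
      per-block true  true  false = z≤n
      per-block true  false δ     = z≤n
      per-block false β     δ     = z≤n

    withAB≤codeg-b : ∀ d → withAB C d ≤ codeg C b d
    withAB≤codeg-b d = ∑∈-mono-≤ (λ {B} _ → per-block (a ∈ᵇ B) (b ∈ᵇ B) (d ∈ᵇ B))
      where
      per-block : ∀ α β δ → 𝟙 α * 𝟙 β * 𝟙 δ ≤ 𝟙 β * 𝟙 δ
      per-block true  true  true  = ≤-refl
      per-block true  true  false = z≤n
      per-block true  false δ     = z≤n
      per-block false β     δ     = z≤n

    withoutAB≤neither : ∀ d → withoutAB C d ≤ neither C
    withoutAB≤neither d = ∑∈-mono-≤ (λ {B} _ → per-block (a ∈ᵇ B) (b ∈ᵇ B) (d ∈ᵇ B))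
      where
      per-block : ∀ α β δ → 𝟙 (not α) * 𝟙 (not β) * 𝟙 δ ≤ 𝟙 (not α) * 𝟙 (not β)
      per-block false false true  = ≤-refl
      per-block false false false = z≤n
      per-block false true  δ     = z≤n
      per-block true  β     δ     = z≤n

    codeg≤ : ∀ x q → codeg C x q ≤ codeg C a q + codeg C b q + withoutAB C x
    codeg≤ x q = begin
      codeg C x q
        ≤⟨ ∑∈-mono-≤ (λ {B} _ → per-block (a ∈ᵇ B) (b ∈ᵇ B) (x ∈ᵇ B) (q ∈ᵇ B)) ⟩
      (∑[ B ∈ C ] 𝟙[ a ∈ B ] * 𝟙[ q ∈ B ] + 𝟙[ b ∈ B ] * 𝟙[ q ∈ B ] + 𝟙[ a ∉ B ] * 𝟙[ b ∉ B ] * 𝟙[ x ∈ B ])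
        ≡⟨ ∑∈-distrib-+ C _ _ ⟩
      _
        ≡⟨ cong (_+ withoutAB C x) (∑∈-distrib-+ C _ _) ⟩
      codeg C a q + codeg C b q + withoutAB C x
        ∎
      where
      open ≤-Reasoning
      per-block : ∀ α β ξ κ → 𝟙 ξ * 𝟙 κ ≤ 𝟙 α * 𝟙 κ + 𝟙 β * 𝟙 κ + 𝟙 (not α) * 𝟙 (not β) * 𝟙 ξ
      per-block α     β     false κ     = z≤n
      per-block α     β     true  false = z≤n
      per-block true  β     true  true  = s≤s z≤n
      per-block false true  true  true  = s≤s z≤n
      per-block false false true  true  = s≤s z≤n

    withoutAB-pair : ∀ x q → withoutAB C x + withoutAB C q ≤ codeg C x q + neither C
    withoutAB-pair x q = begin
      withoutAB C x + withoutAB C q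
        ≡⟨ ∑∈-distrib-+ C _ _ ⟨
      (∑[ B ∈ C ] 𝟙[ a ∉ B ] * 𝟙[ b ∉ B ] * 𝟙[ x ∈ B ] + 𝟙[ a ∉ B ] * 𝟙[ b ∉ B ] * 𝟙[ q ∈ B ])
        ≤⟨ ∑∈-mono-≤ (λ {B} _ → per-block (a ∈ᵇ B) (b ∈ᵇ B) (x ∈ᵇ B) (q ∈ᵇ B)) ⟩
      (∑[ B ∈ C ] 𝟙[ x ∈ B ] * 𝟙[ q ∈ B ] + 𝟙[ a ∉ B ] * 𝟙[ b ∉ B ])
        ≡⟨ ∑∈-distrib-+ C _ _ ⟩
      codeg C x q + neither C
        ∎
      where
      open ≤-Reasoning
      per-block : ∀ α β ξ κ → let α̅β̅ = 𝟙 (not α) * 𝟙 (not β) in α̅β̅ * 𝟙 ξ + α̅β̅ * 𝟙 κ ≤ 𝟙 ξ * 𝟙 κ + α̅β̅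
      per-block true  β     ξ     κ     = z≤n
      per-block false true  ξ     κ     = z≤n
      per-block false false true  true  = ≤-refl
      per-block false false true  false = ≤-refl
      per-block false false false true  = ≤-refl
      per-block false false false false = z≤n

    withAB-pos : ∀ {d} → 0 < withAB C d → ∃ λ B → B ∈ C × All (_∈ₛ B) (a ∷ b ∷ d ∷ [])
    withAB-pos {d} 0<t with ∑∈-pos 0<t
    ... | B , B∈C , 0<abd = B , B∈C , all-in (a ∈ᵇ B) (b ∈ᵇ B) (d ∈ᵇ B) refl refl refl 0<abd
      where
      all-in : ∀ α β δ → a ∈ᵇ B ≡ α → b ∈ᵇ B ≡ β → d ∈ᵇ B ≡ δ → 0 < 𝟙 α * 𝟙 β * 𝟙 δ →
               All (_∈ₛ B) (a ∷ b ∷ d ∷ [])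
      all-in true true true a∈B b∈B d∈B _ = ∈ᵇ⇒∈ a∈B ∷ ∈ᵇ⇒∈ b∈B ∷ ∈ᵇ⇒∈ d∈B ∷ []

  module InTrade {μ m} {T : Fin μ → Collection v} (trade : IsTrade μ v 3 2 m T) where
    open IsTrade trade

    -- A block {a , b , d} is determined by its points, so it lies in only one of the Tᵢ.
    withAB-disjoint : ∀ d → away a b d ≡ true → ∀ i j → 0 < withAB (T i) d → 0 < withAB (T j) d → i ≡ j
    withAB-disjoint d away-d i j 0<tᵢ 0<tⱼ with i ≟ j | withAB-pos (T i) 0<tᵢ | withAB-pos (T j) 0<tⱼ
    ... | yes i≡j | _ | _ = i≡j
    ... | no  i≢j | B , B∈Tᵢ , abd⊆B | B′ , B′∈Tⱼ , abd⊆B′ =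
      contradiction (subst (_∈ T j) (sym B≡B′) B′∈Tⱼ) (disjoint i j i≢j B∈Tᵢ)
      where
      abd-distinct : Unique (a ∷ b ∷ d ∷ [])
      abd-distinct = (a≢b ∷ a≢away d away-d ∷ []) ∷ (b≢away d away-d ∷ []) ∷ [] ∷ []
      B≡B′ = ≡-by-listing abd-distinct (blocks i B∈Tᵢ) (blocks j B′∈Tⱼ) abd⊆B abd⊆B′

    withAB-zero : ∀ d → away a b d ≡ true → ∀ {i j} → i ≢ j → 0 < withAB (T i) d → withAB (T j) d ≡ 0
    withAB-zero d away-d {i} {j} i≢j 0<tᵢ = n≤0⇒n≡0 (≮⇒≥ (i≢j ∘ withAB-disjoint d away-d i j 0<tᵢ))

    codeg-a-balanced : ∀ d → away a b d ≡ true → ∀ i j → codeg (T i) a d ≡ codeg (T j) a d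
    codeg-a-balanced d away-d = codeg-balanced trade (a≢away d away-d)

    codeg-b-balanced : ∀ d → away a b d ≡ true → ∀ i j → codeg (T i) b d ≡ codeg (T j) b d
    codeg-b-balanced d away-d = codeg-balanced trade (b≢away d away-d)

    onlyA-balanced : ∀ i j → onlyA (T i) ≡ onlyA (T j)
    onlyA-balanced i j = *-cancelˡ-≡ _ _ 2 (+-cancelˡ-≡ (codeg (T i) a b) _ _ (begin
      codeg (T i) a b + 2 * onlyA (T i)  ≡⟨ ∑away-codeg-a (blocks i) ⟨
      ∑away (codeg (T i) a)              ≡⟨ ∑⟨⟩-cong (λ d away-d → codeg-a-balanced d away-d i j) ⟩
      ∑away (codeg (T j) a)              ≡⟨ ∑away-codeg-a (blocks j) ⟩
      codeg (T j) a b + 2 * onlyA (T j)  ≡⟨ cong (_+ 2 * onlyA (T j)) (codeg-balanced trade a≢b j i) ⟩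
      codeg (T i) a b + 2 * onlyA (T j)  ∎))
      where open ≡-Reasoning

    onlyB-balanced : ∀ i j → onlyB (T i) ≡ onlyB (T j)
    onlyB-balanced i j = *-cancelˡ-≡ _ _ 2 (+-cancelˡ-≡ (codeg (T i) a b) _ _ (begin
      codeg (T i) a b + 2 * onlyB (T i)  ≡⟨ ∑away-codeg-b (blocks i) ⟨
      ∑away (codeg (T i) b)              ≡⟨ ∑⟨⟩-cong (λ d away-d → codeg-b-balanced d away-d i j) ⟩
      ∑away (codeg (T j) b)              ≡⟨ ∑away-codeg-b (blocks j) ⟩
      codeg (T j) a b + 2 * onlyB (T j)  ≡⟨ cong (_+ 2 * onlyB (T j)) (codeg-balanced trade a≢b j i) ⟩
      codeg (T i) a b + 2 * onlyB (T j)  ∎))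
      where open ≡-Reasoning

    neither-balanced : ∀ i j → neither (T i) ≡ neither (T j)
    neither-balanced i j = +-cancelˡ-≡ (codeg (T i) a b + onlyA (T i) + onlyB (T i)) _ _ (begin
      codeg (T i) a b + onlyA (T i) + onlyB (T i) + neither (T i)  ≡⟨ volume-partition (T i) ⟨
      length (T i)                                                 ≡⟨ trans (volume i) (sym (volume j)) ⟩
      length (T j)                                                 ≡⟨ volume-partition (T j) ⟩
      codeg (T j) a b + onlyA (T j) + onlyB (T j) + neither (T j)  ≡⟨ cong (_+ neither (T j)) same-rest ⟩
      codeg (T i) a b + onlyA (T i) + onlyB (T i) + neither (T j)  ∎)
      where
      open ≡-Reasoning
      same-rest = cong₂ _+_ (cong₂ _+_ (codeg-balanced trade a≢b j i) (onlyA-balanced j i)) (onlyB-balanced j i)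

    withoutAB-withAB-balanced : ∀ d → away a b d ≡ true → ∀ i j →
                                withoutAB (T i) d + withAB (T j) d ≡ withoutAB (T j) d + withAB (T i) d
    withoutAB-withAB-balanced d away-d i j =
      cross-cancel {r = deg (T i) d} {withAB (T i) d} {withAB (T j) d} {codeg (T i) a d + codeg (T i) b d}
        (inclusion-exclusion (T i) d) (begin
          deg (T i) d + withAB (T j) d                           ≡⟨ cong (_+ withAB (T j) d) same-deg ⟩
          deg (T j) d + withAB (T j) d                           ≡⟨ inclusion-exclusion (T j) d ⟩
          codeg (T j) a d + codeg (T j) b d + withoutAB (T j) d  ≡⟨ cong (_+ withoutAB (T j) d) same-codeg ⟩
          codeg (T i) a d + codeg (T i) b d + withoutAB (T j) d  ∎)
      where
      open ≡-Reasoning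
      same-deg = deg-balanced trade d i j
      same-codeg = cong₂ _+_ (codeg-a-balanced d away-d j i) (codeg-b-balanced d away-d j i)

    withAB≤withoutAB : ∀ {i j} → i ≢ j → ∀ d → away a b d ≡ true → withAB (T i) d ≤ withoutAB (T i) d
    withAB≤withoutAB {i} {j} i≢j d away-d with 0 <? withAB (T i) d
    ... | no  ¬0<tᵢ = subst (_≤ withoutAB (T i) d) (sym (n≤0⇒n≡0 (≮⇒≥ ¬0<tᵢ))) z≤n
    ... | yes 0<tᵢ = begin
      withAB (T i) d                      ≤⟨ m≤n+m (withAB (T i) d) (withoutAB (T j) d) ⟩
      withoutAB (T j) d + withAB (T i) d  ≡⟨ withoutAB-withAB-balanced d away-d i j ⟨
      withoutAB (T i) d + withAB (T j) d  ≡⟨ cong (withoutAB (T i) d +_) (withAB-zero d away-d i≢j 0<tᵢ) ⟩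
      withoutAB (T i) d + 0               ≡⟨ +-identityʳ _ ⟩
      withoutAB (T i) d                   ∎
      where open ≤-Reasoning

    codeg≤3*neither : ∀ {i j} → i ≢ j → codeg (T i) a b ≤ 3 * neither (T i)
    codeg≤3*neither {i} i≢j = subst₂ _≤_ (∑away-withAB (blocks i)) (∑away-withoutAB (blocks i))
                                         (∑⟨⟩-mono-≤ (withAB≤withoutAB i≢j))

    withAB-all : Fin v → ℕ
    withAB-all d = ∑[ j < μ ] withAB (T j) d

    ∑away-withAB-all : ∀ i → ∑away withAB-all ≡ μ * codeg (T i) a b
    ∑away-withAB-all i = begin
      ∑away withAB-all                 ≡⟨ ∑⟨⟩-∑-comm (λ j → withAB (T j)) ⟩
      ∑[ j < μ ] ∑away (withAB (T j))  ≡⟨ sum-cong-≗ (λ j → trans (∑away-withAB (blocks j)) (L-balanced j)) ⟩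
      ∑[ j < μ ] codeg (T i) a b       ≡⟨ ∑-const μ _ ⟩
      μ * codeg (T i) a b              ∎
      where
      open ≡-Reasoning
      L-balanced = λ j → codeg-balanced trade a≢b j i

    withAB-all≤ : ∀ d → away a b d ≡ true → ∀ {c} → (∀ j → withAB (T j) d ≤ c) → withAB-all d ≤ c
    withAB-all≤ d away-d = ∑-≤-single-support (withAB-disjoint d away-d)

    module _ (i : Fin μ) {X : Fin v → ℕ} (bound : ∀ j d → away a b d ≡ true → withAB (T j) d ≤ X d) where

      μ*codeg≤∑away : μ * codeg (T i) a b ≤ ∑away X
      μ*codeg≤∑away = begin
        μ * codeg (T i) a b  ≡⟨ ∑away-withAB-all i ⟨
        ∑away withAB-all     ≤⟨ ∑⟨⟩-mono-≤ (λ d away-d → withAB-all≤ d away-d (λ j → bound j d away-d)) ⟩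
        ∑away X              ∎
        where open ≤-Reasoning

      μ*codeg≡∑away⇒≡ : μ * codeg (T i) a b ≡ ∑away X → ∀ d → away a b d ≡ true → withAB-all d ≡ X d
      μ*codeg≡∑away⇒≡ tight = ∑⟨⟩-≡⇒≡ (λ d away-d → withAB-all≤ d away-d (λ j → bound j d away-d))
                                      (trans (∑away-withAB-all i) tight)

    withAB≤codeg-a-in : ∀ i j d → away a b d ≡ true → withAB (T j) d ≤ codeg (T i) a d
    withAB≤codeg-a-in i j d away-d =
      ≤-trans (withAB≤codeg-a (T j) d) (≤-reflexive (codeg-a-balanced d away-d j i))

    withAB≤codeg-b-in : ∀ i j d → away a b d ≡ true → withAB (T j) d ≤ codeg (T i) b d
    withAB≤codeg-b-in i j d away-d =
      ≤-trans (withAB≤codeg-b (T j) d) (≤-reflexive (codeg-b-balanced d away-d j i))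

    μ*codeg≤codeg+2*onlyA : ∀ i → μ * codeg (T i) a b ≤ codeg (T i) a b + 2 * onlyA (T i)
    μ*codeg≤codeg+2*onlyA i =
      subst (μ * codeg (T i) a b ≤_) (∑away-codeg-a (blocks i)) (μ*codeg≤∑away i (withAB≤codeg-a-in i))

    μ*codeg≤codeg+2*onlyB : ∀ i → μ * codeg (T i) a b ≤ codeg (T i) a b + 2 * onlyB (T i)
    μ*codeg≤codeg+2*onlyB i =
      subst (μ * codeg (T i) a b ≤_) (∑away-codeg-b (blocks i)) (μ*codeg≤∑away i (withAB≤codeg-b-in i))

    module _ {i j} (i≢j : i ≢ j) (neither≤1 : neither (T i) ≤ 1) where

      withoutAB≤1 : ∀ p d → withoutAB (T p) d ≤ 1
      withoutAB≤1 p d =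
        ≤-trans (withoutAB≤neither (T p) d) (≤-trans (≤-reflexive (neither-balanced p i)) neither≤1)

      through-triple : ∀ x → away a b x ≡ true → 0 < withAB (T i) x →
                       withoutAB (T j) x ≡ 0 × 1 ≤ withoutAB (T i) x
      through-triple x away-x 0<tᵢx =
        m+n≤1⇒m≡0 0<tᵢx (≤-trans (≤-reflexive (sym nᵢx≡nⱼx+tᵢx)) (withoutAB≤1 i x)) ,
        ≤-trans 0<tᵢx (≤-trans (m≤n+m _ _) (≤-reflexive (sym nᵢx≡nⱼx+tᵢx)))
        where
        nᵢx≡nⱼx+tᵢx : withoutAB (T i) x ≡ withoutAB (T j) x + withAB (T i) x
        nᵢx≡nⱼx+tᵢx = begin
          withoutAB (T i) x                   ≡⟨ +-identityʳ _ ⟨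
          withoutAB (T i) x + 0               ≡⟨ cong (withoutAB (T i) x +_) (withAB-zero x away-x i≢j 0<tᵢx) ⟨
          withoutAB (T i) x + withAB (T j) x  ≡⟨ withoutAB-withAB-balanced x away-x i j ⟩
          withoutAB (T j) x + withAB (T i) x  ∎
          where open ≡-Reasoning

      off-triples : ∀ q → away a b q ≡ true → withAB (T i) q < withoutAB (T i) q →
                    (∀ p → withAB (T p) q ≡ 0) × withoutAB (T i) q ≡ 1
      off-triples q away-q tᵢq<nᵢq = tₚq≡0 , nᵢq≡1
        where
        tᵢq≡0 : withAB (T i) q ≡ 0
        tᵢq≡0 = n≤0⇒n≡0 (s≤s⁻¹ (≤-trans tᵢq<nᵢq (withoutAB≤1 i q)))
        nᵢq≡1 : withoutAB (T i) q ≡ 1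
        nᵢq≡1 = ≤-antisym (withoutAB≤1 i q) (≤-trans (s≤s z≤n) tᵢq<nᵢq)
        tₚq≡0 : ∀ p → withAB (T p) q ≡ 0
        tₚq≡0 p = n≤0⇒n≡0 (s≤s⁻¹ (begin
          1 + withAB (T p) q                  ≡⟨ cong (_+ withAB (T p) q) nᵢq≡1 ⟨
          withoutAB (T i) q + withAB (T p) q  ≡⟨ withoutAB-withAB-balanced q away-q i p ⟩
          withoutAB (T p) q + withAB (T i) q  ≡⟨ cong (withoutAB (T p) q +_) tᵢq≡0 ⟩
          withoutAB (T p) q + 0               ≡⟨ +-identityʳ _ ⟩
          withoutAB (T p) q                   ≤⟨ withoutAB≤1 p q ⟩
          1                                   ∎))
          where open ≤-Reasoning

      -- When the counting is tight, a point x with {a , b , x} ∈ Tᵢ and a point q as in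
      -- off-triples form a pair that some block of Tᵢ covers but no block of Tⱼ does.
      no-tight-pair : 0 < codeg (T i) a b → codeg (T i) a b < 3 * neither (T i) →
                      μ * codeg (T i) a b ≡ codeg (T i) a b + 2 * onlyA (T i) →
                      μ * codeg (T i) a b ≡ codeg (T i) a b + 2 * onlyB (T i) → ⊥
      no-tight-pair 0<L L<3C tightA tightB
        with ∑⟨⟩-pos (subst (0 <_) (sym (∑away-withAB (blocks i))) 0<L)
           | ∑⟨⟩-<⇒∃< (subst₂ _<_ (sym (∑away-withAB (blocks i))) (sym (∑away-withoutAB (blocks i))) L<3C)
      ... | x , away-x , 0<tᵢx | q , away-q , tᵢq<nᵢq
        with through-triple x away-x 0<tᵢx | off-triples q away-q tᵢq<nᵢq
      ... | nⱼx≡0 , 1≤nᵢx | tq≡0 , nᵢq≡1 =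
        <⇒≢ 0<codegᵢxq (sym (trans (codeg-balanced trade x≢q i j) codegⱼxq≡0))
        where
        x≢q : x ≢ q
        x≢q x≡q = <⇒≢ 0<tᵢx (sym (trans (cong (withAB (T i)) x≡q) (tq≡0 i)))

        withAB-all-q≡0 : withAB-all q ≡ 0
        withAB-all-q≡0 = trans (sum-cong-≗ tq≡0) (sum-replicate-zero μ)

        codeg-a-q≡0 : codeg (T j) a q ≡ 0
        codeg-a-q≡0 = begin
          codeg (T j) a q  ≡⟨ codeg-a-balanced q away-q j i ⟩
          codeg (T i) a q  ≡⟨ μ*codeg≡∑away⇒≡ i (withAB≤codeg-a-in i) tightA′ q away-q ⟨
          withAB-all q     ≡⟨ withAB-all-q≡0 ⟩
          0                ∎
          where
          open ≡-Reasoning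
          tightA′ = trans tightA (sym (∑away-codeg-a (blocks i)))

        codeg-b-q≡0 : codeg (T j) b q ≡ 0
        codeg-b-q≡0 = begin
          codeg (T j) b q  ≡⟨ codeg-b-balanced q away-q j i ⟩
          codeg (T i) b q  ≡⟨ μ*codeg≡∑away⇒≡ i (withAB≤codeg-b-in i) tightB′ q away-q ⟨
          withAB-all q     ≡⟨ withAB-all-q≡0 ⟩
          0                ∎
          where
          open ≡-Reasoning
          tightB′ = trans tightB (sym (∑away-codeg-b (blocks i)))

        codegⱼxq≡0 : codeg (T j) x q ≡ 0
        codegⱼxq≡0 = n≤0⇒n≡0 (≤-trans (codeg≤ (T j) x q)
          (≤-reflexive (cong₂ _+_ (cong₂ _+_ codeg-a-q≡0 codeg-b-q≡0) nⱼx≡0)))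

        0<codegᵢxq : 0 < codeg (T i) x q
        0<codegᵢxq = +-cancelʳ-≤ 1 1 (codeg (T i) x q) (begin
          1 + 1                                  ≤⟨ +-mono-≤ 1≤nᵢx (≤-reflexive (sym nᵢq≡1)) ⟩
          withoutAB (T i) x + withoutAB (T i) q  ≤⟨ withoutAB-pair (T i) x q ⟩
          codeg (T i) x q + neither (T i)        ≤⟨ +-monoʳ-≤ (codeg (T i) x q) neither≤1 ⟩
          codeg (T i) x q + 1                    ∎)
          where open ≤-Reasoning

-- Three-way trades of volume 7

volume-7-tight : ∀ {L A B C} → 2 ≤ L → L ≤ A → L ≤ B → 1 ≤ C → L + A + B + C ≡ 7 →
                 L ≡ 2 × A ≡ 2 × B ≡ 2 × C ≡ 1
volume-7-tight 2≤L L≤A L≤B 1≤C sum≡7 =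
  let 2≤A = ≤-trans 2≤L L≤A
      2≤B = ≤-trans 2≤L L≤B
      LAB≡6 , C≡1 = +-tight (+-mono-≤ (+-mono-≤ 2≤L 2≤A) 2≤B) 1≤C sum≡7
      LA≡4  , B≡2 = +-tight (+-mono-≤ 2≤L 2≤A) 2≤B LAB≡6
      L≡2   , A≡2 = +-tight 2≤L 2≤A LA≡4
  in L≡2 , A≡2 , B≡2 , C≡1

another : ∀ (i : Fin (suc (suc n))) → ∃ λ j → i ≢ j
another zero    = suc zero , λ ()
another (suc _) = zero , λ ()

module _ {v} {T : Fin 3 → Collection v} (trade : IsTrade 3 v 3 2 7 T) {a b : Fin v} (a≢b : a ≢ b) where
  open AroundPair a≢b
  open InTrade trade

  codeg≤1 : ∀ i → codeg (T i) a b ≤ 1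
  codeg≤1 i = ≮⇒≥ λ 2≤L →
    let j , i≢j = another i
        L≤A = *-cancelˡ-≤ 2 (+-cancelˡ-≤ (codeg (T i) a b) _ _ (μ*codeg≤codeg+2*onlyA i))
        L≤B = *-cancelˡ-≤ 2 (+-cancelˡ-≤ (codeg (T i) a b) _ _ (μ*codeg≤codeg+2*onlyB i))
        1≤C = *-cancelˡ-< 3 0 (neither (T i)) (≤-trans (s≤s z≤n) (≤-trans 2≤L (codeg≤3*neither i≢j)))
        volume≡7 = trans (sym (volume-partition (T i))) (IsTrade.volume trade i)
        L≡2 , A≡2 , B≡2 , C≡1 = volume-7-tight 2≤L L≤A L≤B 1≤C volume≡7
    in no-tight-pair i≢j (≤-reflexive C≡1)
         (≤-trans (s≤s z≤n) 2≤L)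
         (subst₂ _<_ (sym L≡2) (cong (3 *_) (sym C≡1)) ≤-refl)
         (cong (λ y → codeg (T i) a b + 2 * y) (trans L≡2 (sym A≡2)))
         (cong (λ y → codeg (T i) a b + 2 * y) (trans L≡2 (sym B≡2)))

theorem4p1 : (v : ℕ) → 3 < v → (T : Fin 3 → Collection v) →
    IsTrade 3 v 3 2 7 T → IsSteinerTrade 3 v 3 2 7 T
theorem4p1 v _ T trade = record { trade = trade ; steiner = steiner }
  where
  steiner : ∀ S → IsKSubset 2 S → ∀ i → occ S (T i) ≤ 1
  steiner S ∣S∣≡2 i with ∣p∣≡2⇒IsPair ∣S∣≡2
  ... | a , b , a≢b , S≈ab = subst (_≤ 1) (sym (occ-pair S≈ab (T i))) (codeg≤1 trade a≢b i)
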